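{- Let $k\geq 2$ and $n$ be positive integers with $n\geq 2^{k}-k$, and let $a_1<a_2<\cdots<a_k$ be positive integers satisfying $\frac{n}{2^{n}}=\sum_{i=1}^{k}\frac{a_{i}}{2^{a_{i}}}$. Then $a_k\leq 2(k+n)$. -}

module Defs where

open import Data.Nat using (ℕ; _^_)
open import Data.Nat.Properties using (m^n≢0)
open import Data.Integer using (+_)
open import Data.Rational using (ℚ; _/_; 0ℚ; _+_)
open import Data.Fin using (Fin)
open import Data.Vec.Functional using (foldr)

term : ℕ → ℚ
term m = (+ m) / (2 ^ m)
  where instance _ = m^n≢0 2 m

sumℚ : ∀ {k} → (Fin k → ℚ) → ℚ
sumℚ f = foldr _+_ 0ℚ f

-- Put b = a_k and clear denominators: n·2^b = S·2^n with S = Σ aᵢ·2^(b−aᵢ). As m/2^m is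
-- non-increasing, n < a₁, so S = n·2^(b−n) is divisible by 2^(b−a₁). Whenever 2^(b−aᵢ) divides
-- the partial sum from aᵢ on, it divides the partial sum from aᵢ₊₁ on and is therefore at most
-- that sum, while each partial sum is at most 2b·2^(b−aᵢ) (a geometric series). Descending
-- through the k terms gives n·2^(b−n) ≤ 2^(k−1)·b^k. For n ≥ 2^k − k this polynomial bound is
-- beaten by the exponential once b > 2(k+n): by induction on n at b = 2(k+n)+1 and then on b,
-- each step resting on (B+2)^k ≤ 2·B^k for B ≥ 4k.

module Submission where

open import Defs
open import Data.Nat using (ℕ; zero; suc; _≤_; _<_; _≤′_; ≤′-refl; ≤′-step; _+_; _*_; _∸_; _^_; NonZero; >-nonZero; z≤n; s≤s; z<s)
open import Data.Nat.Properties
open import Data.Nat.Tactic.RingSolver using (solve-∀)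
open import Algebra.Properties.CommutativeSemigroup *-commutativeSemigroup using (x∙yz≈y∙xz; x∙yz≈xz∙y; xy∙z≈xz∙y; xy∙z≈y∙xz)
open import Data.Fin as Fin using (Fin; toℕ; fromℕ) renaming (_<_ to _<ᶠ_)
open import Data.Fin.Properties using (toℕ-injective; toℕ-fromℕ; ≤fromℕ)
open import Data.Nat.Divisibility using (_∣_; divides; ∣⇒≤; ∣-trans; ∣m+n∣m⇒∣n; n∣m*n)
open import Data.Sum using (inj₁; inj₂)
open import Relation.Nullary using (¬_)
import Data.Integer as ℤ
open import Data.Integer.Properties using (pos-+; pos-*) renaming (+-injective to pos-injective)
open import Data.Rational as ℚ using (toℚᵘ)
open import Data.Rational.Properties using (toℚᵘ-fromℚᵘ; toℚᵘ-homo-+; toℚᵘ-cong)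
open import Data.Rational.Unnormalised using (*≡*) renaming (_≃_ to _≃ᵘ_; _+_ to _+ᵘ_; _/_ to _/ᵘ_)
open import Data.Rational.Unnormalised.Properties using (≃-sym; ≃-trans; ≃-reflexive; +-cong; /-cong)
open import Data.Vec.Functional using (head; tail)
open import Relation.Binary.PropositionalEquality

-- 2^b · Σᵢ aᵢ/2^aᵢ when every aᵢ ≤ b.
clearedSum : ℕ → ∀ {k} → (Fin k → ℕ) → ℕ
clearedSum b {zero}  a = 0
clearedSum b {suc k} a = head a * 2 ^ (b ∸ head a) + clearedSum b (tail a)

p*e≡q*d⇒p/d≃q/e : ∀ {p q} d e .{{_ : NonZero d}} .{{_ : NonZero e}} →
                   p * e ≡ q * d → (ℤ.+ p) /ᵘ d ≃ᵘ (ℤ.+ q) /ᵘ e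
p*e≡q*d⇒p/d≃q/e {p} {q} (suc d) (suc e) eq =
  *≡* (trans (sym (pos-* p (suc e))) (trans (cong ℤ.+_ eq) (pos-* q (suc d))))

p/d≃q/e⇒p*e≡q*d : ∀ {p q} d e .{{_ : NonZero d}} .{{_ : NonZero e}} →
                   (ℤ.+ p) /ᵘ d ≃ᵘ (ℤ.+ q) /ᵘ e → p * e ≡ q * d
p/d≃q/e⇒p*e≡q*d {p} {q} (suc d) (suc e) (*≡* eq) =
  pos-injective (trans (pos-* p (suc e)) (trans eq (sym (pos-* q (suc d)))))

p/d+q/d≃[p+q]/d : ∀ p q d .{{_ : NonZero d}} → (ℤ.+ p) /ᵘ d +ᵘ (ℤ.+ q) /ᵘ d ≃ᵘ (ℤ.+ (p + q)) /ᵘ d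
p/d+q/d≃[p+q]/d p q d@(suc _) =
  ≃-trans (≃-reflexive (/-cong numerator refl)) (p*e≡q*d⇒p/d≃q/e (d * d) d (regroup p q d))
  where
  numerator : (ℤ.+ p) ℤ.* (ℤ.+ d) ℤ.+ (ℤ.+ q) ℤ.* (ℤ.+ d) ≡ ℤ.+ (p * d + q * d)
  numerator = sym (trans (pos-+ (p * d) (q * d)) (cong₂ ℤ._+_ (pos-* p d) (pos-* q d)))
  regroup : ∀ p q d → (p * d + q * d) * d ≡ (p + q) * (d * d)
  regroup = solve-∀

toℚᵘ-/ : ∀ i d .{{_ : NonZero d}} → toℚᵘ (i ℚ./ d) ≃ᵘ i /ᵘ d
toℚᵘ-/ i (suc d) = toℚᵘ-fromℚᵘ (i /ᵘ suc d)

toℚᵘ-term : ∀ x b → x ≤ b →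
            toℚᵘ (term x) ≃ᵘ ((ℤ.+ (x * 2 ^ (b ∸ x))) /ᵘ 2 ^ b) {{m^n≢0 2 b}}
toℚᵘ-term x b x≤b = ≃-trans (toℚᵘ-/ (ℤ.+ x) (2 ^ x)) (p*e≡q*d⇒p/d≃q/e (2 ^ x) (2 ^ b) (begin
  x * 2 ^ b                    ≡⟨ cong (λ e → x * 2 ^ e) (sym (m+[n∸m]≡n x≤b)) ⟩
  x * 2 ^ (x + (b ∸ x))        ≡⟨ cong (x *_) (^-distribˡ-+-* 2 x (b ∸ x)) ⟩
  x * (2 ^ x * 2 ^ (b ∸ x))    ≡⟨ x∙yz≈xz∙y x (2 ^ x) (2 ^ (b ∸ x)) ⟩
  x * 2 ^ (b ∸ x) * 2 ^ x      ∎))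
  where
  open ≡-Reasoning
  instance _ = m^n≢0 2 x
  instance _ = m^n≢0 2 b

toℚᵘ-sumℚ-term : ∀ b {k} (a : Fin k → ℕ) → (∀ i → a i ≤ b) →
                 toℚᵘ (sumℚ (λ i → term (a i))) ≃ᵘ ((ℤ.+ clearedSum b a) /ᵘ 2 ^ b) {{m^n≢0 2 b}}
toℚᵘ-sumℚ-term b {zero}  a a≤b = p*e≡q*d⇒p/d≃q/e 1 (2 ^ b) {{_}} {{m^n≢0 2 b}} refl
toℚᵘ-sumℚ-term b {suc k} a a≤b =
  ≃-trans (toℚᵘ-homo-+ (term (head a)) _)
    (≃-trans (+-cong (toℚᵘ-term (head a) b (a≤b _)) (toℚᵘ-sumℚ-term b (tail a) (λ i → a≤b (Fin.suc i))))
      (p/d+q/d≃[p+q]/d _ _ (2 ^ b) {{m^n≢0 2 b}}))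

term≡sumℚ⇒cleared : ∀ n b {k} (a : Fin k → ℕ) → (∀ i → a i ≤ b) →
                    term n ≡ sumℚ (λ i → term (a i)) → n * 2 ^ b ≡ clearedSum b a * 2 ^ n
term≡sumℚ⇒cleared n b a a≤b eq = p/d≃q/e⇒p*e≡q*d (2 ^ n) (2 ^ b)
  (≃-trans (≃-sym (toℚᵘ-/ (ℤ.+ n) (2 ^ n))) (≃-trans (toℚᵘ-cong eq) (toℚᵘ-sumℚ-term b a a≤b)))
  where
  instance _ = m^n≢0 2 n
  instance _ = m^n≢0 2 b

Increasing : ∀ {k} → (Fin k → ℕ) → Set
Increasing a = ∀ i j → i <ᶠ j → a i < a j

Increasing-tail : ∀ {k} {a : Fin (suc k) → ℕ} → Increasing a → Increasing (tail a)
Increasing-tail inc i j i<j = inc (Fin.suc i) (Fin.suc j) (s≤s i<j)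

Increasing⇒head<head-tail : ∀ {k} {a : Fin (suc (suc k)) → ℕ} → Increasing a → head a < head (tail a)
Increasing⇒head<head-tail inc = inc Fin.zero (Fin.suc Fin.zero) (s≤s z≤n)

Increasing⇒≤last : ∀ {k} {a : Fin (suc k) → ℕ} → Increasing a → ∀ i → a i ≤ a (fromℕ k)
Increasing⇒≤last {a = a} inc i with m≤n⇒m<n∨m≡n (≤fromℕ i)
... | inj₁ i<last = <⇒≤ (inc i _ i<last)
... | inj₂ i≡last = ≤-reflexive (cong a (toℕ-injective i≡last))

last≡fromℕ : ∀ {k} (last : Fin (suc k)) → toℕ last + 1 ≡ suc k → last ≡ fromℕ k
last≡fromℕ {k} last eq =
  toℕ-injective (trans (suc-injective (trans (+-comm 1 (toℕ last)) eq)) (sym (toℕ-fromℕ k)))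

^-monoʳ-∣ : ∀ x {m n} → m ≤ n → x ^ m ∣ x ^ n
^-monoʳ-∣ x {m} {n} m≤n =
  divides (x ^ (n ∸ m)) (trans (cong (x ^_) (sym (m∸n+n≡m m≤n))) (^-distribˡ-+-* x (n ∸ m) m))

clearedSum-positive : ∀ b {k} (a : Fin (suc k) → ℕ) → 0 < head a → 0 < clearedSum b a
clearedSum-positive b a 0<a₀ = ≤-trans (*-mono-≤ 0<a₀ (m^n>0 2 (b ∸ head a))) (m≤m+n _ _)

head-term<clearedSum : ∀ b {k} (a : Fin (suc (suc k)) → ℕ) → Increasing a →
                       head a * 2 ^ (b ∸ head a) < clearedSum b a
head-term<clearedSum b a inc =
  m<m+n _ (clearedSum-positive b (tail a) (≤-<-trans z≤n (Increasing⇒head<head-tail inc)))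

clearedSum-geometric : ∀ b {k} (a : Fin (suc k) → ℕ) → Increasing a → (∀ i → a i ≤ b) →
                       clearedSum b a ≤ 2 * b * 2 ^ (b ∸ head a)
clearedSum-geometric b {zero} a inc a≤b = begin
  head a * 2 ^ (b ∸ head a) + 0  ≡⟨ +-identityʳ _ ⟩
  head a * 2 ^ (b ∸ head a)      ≤⟨ *-monoˡ-≤ _ (≤-trans (a≤b Fin.zero) (m≤n*m b 2)) ⟩
  2 * b * 2 ^ (b ∸ head a)       ∎
  where open ≤-Reasoning
clearedSum-geometric b {suc k} a inc a≤b = begin
  head a * P₀ + clearedSum b (tail a)  ≤⟨ +-mono-≤ (*-monoˡ-≤ P₀ (a≤b Fin.zero))
                                           (clearedSum-geometric b (tail a) (Increasing-tail inc) (λ i → a≤b (Fin.suc i))) ⟩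
  b * P₀ + 2 * b * P₁                  ≡⟨ cong (b * P₀ +_) (xy∙z≈y∙xz 2 b P₁) ⟩
  b * P₀ + b * (2 * P₁)                ≤⟨ +-monoʳ-≤ (b * P₀) (*-monoʳ-≤ b 2P₁≤P₀) ⟩
  b * P₀ + b * P₀                      ≡⟨ doubling b P₀ ⟩
  2 * b * P₀                           ∎
  where
  open ≤-Reasoning
  P₀ = 2 ^ (b ∸ head a)
  P₁ = 2 ^ (b ∸ head (tail a))
  2P₁≤P₀ : 2 * P₁ ≤ P₀
  2P₁≤P₀ = ^-monoʳ-≤ 2 (∸-monoʳ-< (Increasing⇒head<head-tail inc) (a≤b (Fin.suc Fin.zero)))
  doubling : ∀ b x → b * x + b * x ≡ 2 * b * x
  doubling = solve-∀

clearedSum-bound : ∀ b {k} (a : Fin (suc k) → ℕ) → Increasing a → a (fromℕ k) ≡ b →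
                   2 ^ (b ∸ head a) ∣ clearedSum b a → clearedSum b a ≤ 2 ^ k * b ^ suc k
clearedSum-bound b {zero} a inc a₀≡b _ rewrite a₀≡b | n∸n≡0 b = ≤-reflexive (unit b)
  where
  unit : ∀ b → b * 1 + 0 ≡ 1 * (b * 1)
  unit = solve-∀
clearedSum-bound b {suc k} a inc last≡b P₀∣S = begin
  clearedSum b a               ≤⟨ clearedSum-geometric b a inc a≤b ⟩
  2 * b * P₀                   ≤⟨ *-monoʳ-≤ (2 * b) (∣⇒≤ {{>-nonZero T>0}} P₀∣T) ⟩
  2 * b * T                    ≤⟨ *-monoʳ-≤ (2 * b) (clearedSum-bound b (tail a) (Increasing-tail inc) last≡b P₁∣T) ⟩
  2 * b * (2 ^ k * b ^ suc k)  ≡⟨ regroup b (2 ^ k) (b ^ suc k) ⟩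
  2 ^ suc k * b ^ suc (suc k)  ∎
  where
  open ≤-Reasoning
  P₀ = 2 ^ (b ∸ head a)
  T = clearedSum b (tail a)
  a≤b : ∀ i → a i ≤ b
  a≤b i = subst (a i ≤_) last≡b (Increasing⇒≤last inc i)
  a₀<a₁ : head a < head (tail a)
  a₀<a₁ = Increasing⇒head<head-tail inc
  T>0 : 0 < T
  T>0 = clearedSum-positive b (tail a) (≤-<-trans z≤n a₀<a₁)
  P₀∣T : P₀ ∣ T
  P₀∣T = ∣m+n∣m⇒∣n P₀∣S (n∣m*n (head a))
  P₁∣T : 2 ^ (b ∸ head (tail a)) ∣ T
  P₁∣T = ∣-trans (^-monoʳ-∣ 2 (∸-monoʳ-≤ b (<⇒≤ a₀<a₁))) P₀∣T
  regroup : ∀ b x y → 2 * b * (x * y) ≡ 2 * x * (b * y)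
  regroup = solve-∀

m+n≤m*2^n : ∀ m n → 1 ≤ m → m + n ≤ m * 2 ^ n
m+n≤m*2^n m zero    1≤m = ≤-reflexive (trans (+-identityʳ m) (sym (*-identityʳ m)))
m+n≤m*2^n m (suc n) 1≤m = begin
  m + suc n              ≡⟨ +-suc m n ⟩
  suc (m + n)            ≤⟨ s≤s (m+n≤m*2^n m n 1≤m) ⟩
  suc (m * 2 ^ n)        ≤⟨ +-monoˡ-≤ (m * 2 ^ n) (*-mono-≤ 1≤m (m^n>0 2 n)) ⟩
  m * 2 ^ n + m * 2 ^ n  ≡⟨ doubling m (2 ^ n) ⟩
  m * 2 ^ suc n          ∎
  where
  open ≤-Reasoning
  doubling : ∀ m x → m * x + m * x ≡ m * (2 * x)
  doubling = solve-∀

m≤n⇒n*2^m≤m*2^n : ∀ {m n} → 1 ≤ m → m ≤ n → n * 2 ^ m ≤ m * 2 ^ n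
m≤n⇒n*2^m≤m*2^n {m} {n} 1≤m m≤n = begin
  n * 2 ^ m                    ≡⟨ cong (_* 2 ^ m) (sym (m+[n∸m]≡n m≤n)) ⟩
  (m + (n ∸ m)) * 2 ^ m        ≤⟨ *-monoˡ-≤ (2 ^ m) (m+n≤m*2^n m (n ∸ m) 1≤m) ⟩
  m * 2 ^ (n ∸ m) * 2 ^ m      ≡⟨ *-assoc m _ _ ⟩
  m * (2 ^ (n ∸ m) * 2 ^ m)    ≡⟨ cong (m *_) (^-distribˡ-+-* 2 (n ∸ m) m) ⟨
  m * 2 ^ (n ∸ m + m)          ≡⟨ cong (λ e → m * 2 ^ e) (m∸n+n≡m m≤n) ⟩
  m * 2 ^ n                    ∎
  where open ≤-Reasoning

cleared⇒n<head : ∀ n b {k} (a : Fin (suc (suc k)) → ℕ) → Increasing a → 1 ≤ head a → head a ≤ b →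
                 n * 2 ^ b ≡ clearedSum b a * 2 ^ n → n < head a
cleared⇒n<head n b a inc 1≤a₀ a₀≤b eq = ≰⇒> λ a₀≤n → <-irrefl eq (begin-strict
  n * 2 ^ b                         ≡⟨ cong (n *_) split ⟩
  n * (2 ^ a₀ * 2 ^ (b ∸ a₀))       ≡⟨ *-assoc n _ _ ⟨
  n * 2 ^ a₀ * 2 ^ (b ∸ a₀)         ≤⟨ *-monoˡ-≤ _ (m≤n⇒n*2^m≤m*2^n 1≤a₀ a₀≤n) ⟩
  a₀ * 2 ^ n * 2 ^ (b ∸ a₀)         ≡⟨ xy∙z≈xz∙y a₀ (2 ^ n) _ ⟩
  a₀ * 2 ^ (b ∸ a₀) * 2 ^ n         <⟨ *-monoˡ-< (2 ^ n) {{m^n≢0 2 n}} (head-term<clearedSum b a inc) ⟩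
  clearedSum b a * 2 ^ n            ∎)
  where
  open ≤-Reasoning
  a₀ = head a
  split : 2 ^ b ≡ 2 ^ a₀ * 2 ^ (b ∸ a₀)
  split = trans (cong (2 ^_) (sym (m+[n∸m]≡n a₀≤b))) (^-distribˡ-+-* 2 a₀ (b ∸ a₀))

cleared⇒n*2^[b∸n]≤2^k*b^[1+k] : ∀ n b {k} (a : Fin (suc k) → ℕ) → Increasing a → a (fromℕ k) ≡ b →
                                n < head a → n * 2 ^ b ≡ clearedSum b a * 2 ^ n →
                                n * 2 ^ (b ∸ n) ≤ 2 ^ k * b ^ suc k
cleared⇒n*2^[b∸n]≤2^k*b^[1+k] n b {k} a inc last≡b n<a₀ eq =
  subst (_≤ 2 ^ k * b ^ suc k) (sym n*2^[b∸n]≡S) (clearedSum-bound b a inc last≡b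
    (subst (2 ^ (b ∸ head a) ∣_) n*2^[b∸n]≡S (∣-trans (^-monoʳ-∣ 2 (∸-monoʳ-≤ b (<⇒≤ n<a₀))) (n∣m*n n))))
  where
  n*2^[b∸n]≡S : n * 2 ^ (b ∸ n) ≡ clearedSum b a
  n*2^[b∸n]≡S = *-cancelʳ-≡ _ _ (2 ^ n) {{m^n≢0 2 n}} (begin
    n * 2 ^ (b ∸ n) * 2 ^ n    ≡⟨ *-assoc n _ _ ⟩
    n * (2 ^ (b ∸ n) * 2 ^ n)  ≡⟨ cong (n *_) (^-distribˡ-+-* 2 (b ∸ n) n) ⟨
    n * 2 ^ (b ∸ n + n)        ≡⟨ cong (λ e → n * 2 ^ e) (m∸n+n≡m n≤b) ⟩
    n * 2 ^ b                  ≡⟨ eq ⟩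
    clearedSum b a * 2 ^ n     ∎)
    where
    open ≡-Reasoning
    n≤b : n ≤ b
    n≤b = <⇒≤ (<-≤-trans n<a₀ (subst (head a ≤_) last≡b (Increasing⇒≤last inc _)))

pow-shift-≤ : ∀ r k d → (r + (d + r * k)) ^ k * d ≤ (d + r * k) ^ suc k
pow-shift-≤ r zero    d = ≤-reflexive (base r d)
  where
  base : ∀ r d → 1 * d ≡ (d + r * 0) * 1
  base = solve-∀
pow-shift-≤ r (suc k) d = subst (λ B → (r + B) ^ suc k * d ≤ B ^ suc (suc k)) (sym (shift r k d)) (begin
  (r + B) ^ suc k * d            ≡⟨ *-assoc (r + B) _ d ⟩
  (r + B) * ((r + B) ^ k * d)    ≡⟨ expand B r ((r + B) ^ k) d ⟩
  (r + B) ^ k * (B * d + r * d)  ≤⟨ *-monoʳ-≤ ((r + B) ^ k) (+-monoʳ-≤ (B * d) (*-monoʳ-≤ r d≤B)) ⟩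
  (r + B) ^ k * (B * d + r * B)  ≡⟨ collect B r ((r + B) ^ k) d ⟩
  B * ((r + B) ^ k * (d + r))    ≤⟨ *-monoʳ-≤ B (pow-shift-≤ r k (d + r)) ⟩
  B * B ^ suc k                  ∎)
  where
  open ≤-Reasoning
  B = d + r + r * k
  d≤B : d ≤ B
  d≤B = ≤-trans (m≤m+n d r) (m≤m+n (d + r) (r * k))
  shift : ∀ r k d → d + r * suc k ≡ d + r + r * k
  shift = solve-∀
  expand : ∀ B r X d → (r + B) * (X * d) ≡ X * (B * d + r * d)
  expand = solve-∀
  collect : ∀ B r X d → X * (B * d + r * B) ≡ B * (X * (d + r))
  collect = solve-∀

pow-+2≤2*pow : ∀ k B → 4 * k ≤ B → (2 + B) ^ k ≤ 2 * B ^ k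
pow-+2≤2*pow zero      B _    = s≤s z≤n
pow-+2≤2*pow k@(suc _) B 4k≤B = *-cancelʳ-≤ _ _ d {{>-nonZero (≤-trans (s≤s z≤n) 2k≤d)}} (begin
  (2 + B) ^ k * d  ≤⟨ subst (λ x → (2 + x) ^ k * d ≤ x ^ suc k) d+2k≡B (pow-shift-≤ 2 k d) ⟩
  B * B ^ k        ≤⟨ *-monoˡ-≤ (B ^ k) B≤2d ⟩
  2 * d * B ^ k    ≡⟨ xy∙z≈xz∙y 2 d (B ^ k) ⟩
  2 * B ^ k * d    ∎)
  where
  open ≤-Reasoning
  d = B ∸ 2 * k
  2k+2k≤B : 2 * k + 2 * k ≤ B
  2k+2k≤B = subst (_≤ B) (double k) 4k≤B
    where
    double : ∀ k → 4 * k ≡ 2 * k + 2 * k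
    double = solve-∀
  d+2k≡B : d + 2 * k ≡ B
  d+2k≡B = m∸n+n≡m (≤-trans (m≤m+n (2 * k) (2 * k)) 2k+2k≤B)
  2k≤d : 2 * k ≤ d
  2k≤d = subst (_≤ d) (m+n∸n≡m (2 * k) (2 * k)) (∸-monoˡ-≤ (2 * k) 2k+2k≤B)
  B≤2d : B ≤ 2 * d
  B≤2d = subst (_≤ 2 * d) d+2k≡B (+-monoʳ-≤ d (subst (2 * k ≤_) (sym (+-identityʳ d)) 2k≤d))

-- For b = n + c, the negation of the bound n·2^(b−n) ≤ 2^(k−1)·b^k.
ExpBeatsPoly : ℕ → ℕ → ℕ → Set
ExpBeatsPoly k n c = 2 ^ k * (n + c) ^ k < 2 * n * 2 ^ c

ExpBeatsPoly-step : ∀ k n c → 4 * k ≤ n + c → ExpBeatsPoly k n c →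
                    2 ^ k * (2 + (n + c)) ^ k < 2 * n * 2 ^ suc c
ExpBeatsPoly-step k n c 4k≤n+c beats = begin-strict
  2 ^ k * (2 + (n + c)) ^ k    ≤⟨ *-monoʳ-≤ (2 ^ k) (pow-+2≤2*pow k (n + c) 4k≤n+c) ⟩
  2 ^ k * (2 * (n + c) ^ k)    ≡⟨ x∙yz≈y∙xz (2 ^ k) 2 _ ⟩
  2 * (2 ^ k * (n + c) ^ k)    <⟨ *-monoʳ-< 2 beats ⟩
  2 * (2 * n * 2 ^ c)          ≡⟨ x∙yz≈y∙xz 2 (2 * n) (2 ^ c) ⟩
  2 * n * 2 ^ suc c            ∎
  where open ≤-Reasoning

ExpBeatsPoly-suc-c : ∀ k n c → 4 * k ≤ n + c → ExpBeatsPoly k n c → ExpBeatsPoly k n (suc c)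
ExpBeatsPoly-suc-c k n c 4k≤n+c beats = ≤-<-trans
  (*-monoʳ-≤ (2 ^ k) (^-monoˡ-≤ k (≤-trans (≤-reflexive (+-suc n c)) (n≤1+n _))))
  (ExpBeatsPoly-step k n c 4k≤n+c beats)

ExpBeatsPoly-suc-n-c : ∀ k n c → 4 * k ≤ n + c → ExpBeatsPoly k n c → ExpBeatsPoly k (suc n) (suc c)
ExpBeatsPoly-suc-n-c k n c 4k≤n+c beats = begin-strict
  2 ^ k * (suc n + suc c) ^ k  ≡⟨ cong (λ x → 2 ^ k * suc x ^ k) (+-suc n c) ⟩
  2 ^ k * (2 + (n + c)) ^ k    <⟨ ExpBeatsPoly-step k n c 4k≤n+c beats ⟩
  2 * n * 2 ^ suc c            ≤⟨ *-monoˡ-≤ (2 ^ suc c) (*-monoʳ-≤ 2 (n≤1+n n)) ⟩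
  2 * suc n * 2 ^ suc c        ∎
  where open ≤-Reasoning

n+n≤2^n : ∀ n → n + n ≤ 2 ^ n
n+n≤2^n zero          = z≤n
n+n≤2^n (suc zero)    = ≤-refl
n+n≤2^n (suc (suc n)) = begin
  suc (suc n) + suc (suc n)  ≡⟨ cong suc (+-suc (suc n) (suc n)) ⟩
  2 + (suc n + suc n)        ≤⟨ +-mono-≤ (*-monoʳ-≤ 2 (m^n>0 2 n)) (n+n≤2^n (suc n)) ⟩
  2 ^ suc n + 2 ^ suc n      ≡⟨ cong (2 ^ suc n +_) (+-identityʳ (2 ^ suc n)) ⟨
  2 ^ suc (suc n)            ∎
  where open ≤-Reasoning

n≤2^n∸n : ∀ n → n ≤ 2 ^ n ∸ n
n≤2^n∸n n = m+n≤o⇒m≤o∸n n (n+n≤2^n n)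

[8+j]*[6+j]≤2^[6+j] : ∀ j → (8 + j) * (6 + j) ≤ 2 ^ (6 + j)
[8+j]*[6+j]≤2^[6+j] zero    = <ᵇ⇒< 47 64 _
[8+j]*[6+j]≤2^[6+j] (suc j) = begin
  (9 + j) * (7 + j)        ≤⟨ m≤m+n _ (33 + 12 * j + j * j) ⟩
  (9 + j) * (7 + j) + (33 + 12 * j + j * j)  ≡⟨ expand j ⟩
  2 * ((8 + j) * (6 + j))  ≤⟨ *-monoʳ-≤ 2 ([8+j]*[6+j]≤2^[6+j] j) ⟩
  2 ^ (7 + j)              ∎
  where
  open ≤-Reasoning
  expand : ∀ j → (9 + j) * (7 + j) + (33 + 12 * j + j * j) ≡ 2 * ((8 + j) * (6 + j))
  expand = solve-∀

ExpBeatsPoly-base-large : ∀ k n → 1 ≤ n → n + k ≡ 2 ^ k → (2 + k) * k ≤ 2 ^ k →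
                          ExpBeatsPoly k n (n + 2 * k + 1)
ExpBeatsPoly-base-large k n 1≤n n+k≡2^k [2+k]k≤2^k = begin-strict
  2 ^ k * (n + c) ^ k              ≡⟨ cong (λ x → 2 ^ k * x ^ k) (double n k) ⟩
  2 ^ k * (2 * (n + k) + 1) ^ k    ≡⟨ cong (λ x → 2 ^ k * (2 * x + 1) ^ k) n+k≡2^k ⟩
  2 ^ k * (2 ^ suc k + 1) ^ k      ≤⟨ *-monoʳ-≤ (2 ^ k) (^-monoˡ-≤ k 2^[k+1]+1≤2^[2+k]) ⟩
  2 ^ k * (2 ^ (2 + k)) ^ k        ≡⟨ cong (2 ^ k *_) (^-*-assoc 2 (2 + k) k) ⟩
  2 ^ k * 2 ^ ((2 + k) * k)        ≡⟨ ^-distribˡ-+-* 2 k ((2 + k) * k) ⟨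
  2 ^ (k + (2 + k) * k)            <⟨ ^-monoʳ-< 2 (s≤s (s≤s z≤n)) exponent< ⟩
  2 * 2 ^ c                        ≤⟨ *-monoˡ-≤ (2 ^ c) (*-monoʳ-≤ 2 1≤n) ⟩
  2 * n * 2 ^ c                    ∎
  where
  open ≤-Reasoning
  c = n + 2 * k + 1
  double : ∀ n k → n + (n + 2 * k + 1) ≡ 2 * (n + k) + 1
  double = solve-∀
  2^[k+1]+1≤2^[2+k] : 2 ^ suc k + 1 ≤ 2 ^ (2 + k)
  2^[k+1]+1≤2^[2+k] = begin
    2 ^ suc k + 1          ≤⟨ +-monoʳ-≤ (2 ^ suc k) (m^n>0 2 (suc k)) ⟩
    2 ^ suc k + 2 ^ suc k  ≡⟨ cong (2 ^ suc k +_) (+-identityʳ (2 ^ suc k)) ⟨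
    2 ^ (2 + k)            ∎
  exponent< : k + (2 + k) * k < suc c
  exponent< = begin-strict
    k + (2 + k) * k  ≤⟨ +-monoʳ-≤ k [2+k]k≤2^k ⟩
    k + 2 ^ k        ≡⟨ cong (k +_) n+k≡2^k ⟨
    k + (n + k)      ≡⟨ regroup k n ⟩
    n + 2 * k        <⟨ m<m+n (n + 2 * k) z<s ⟩
    c                <⟨ n<1+n c ⟩
    suc c            ∎
    where
    regroup : ∀ k n → k + (n + k) ≡ n + 2 * k
    regroup = solve-∀

ExpBeatsPoly-base : ∀ k → 2 ≤ k → ExpBeatsPoly k (2 ^ k ∸ k) (2 ^ k ∸ k + 2 * k + 1)
ExpBeatsPoly-base 0 ()
ExpBeatsPoly-base 1 (s≤s ())
ExpBeatsPoly-base 2 _ = <ᵇ⇒< _ _ _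
ExpBeatsPoly-base 3 _ = <ᵇ⇒< _ _ _
ExpBeatsPoly-base 4 _ = <ᵇ⇒< _ _ _
ExpBeatsPoly-base 5 _ = <ᵇ⇒< _ _ _
ExpBeatsPoly-base k@(suc (suc (suc (suc (suc (suc j)))))) _ =
  ExpBeatsPoly-base-large k (2 ^ k ∸ k) (≤-trans (s≤s z≤n) (n≤2^n∸n k))
    (m∸n+n≡m (m+n≤o⇒n≤o k (n+n≤2^n k)))
    ([8+j]*[6+j]≤2^[6+j] j)

4k≤n+c : ∀ {k n c} → k ≤ n → n + 2 * k + 1 ≤ c → 4 * k ≤ n + c
4k≤n+c {k} {n} {c} k≤n n+2k+1≤c = begin
  4 * k            ≡⟨ split k ⟩
  k + (k + 2 * k)  ≤⟨ +-mono-≤ k≤n (+-monoˡ-≤ (2 * k) k≤n) ⟩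
  n + (n + 2 * k)  ≤⟨ +-monoʳ-≤ n (≤-trans (m≤m+n (n + 2 * k) 1) n+2k+1≤c) ⟩
  n + c            ∎
  where
  open ≤-Reasoning
  split : ∀ k → 4 * k ≡ k + (k + 2 * k)
  split = solve-∀

ExpBeatsPoly-diagonal : ∀ {k n} → 2 ≤ k → 2 ^ k ∸ k ≤′ n → ExpBeatsPoly k n (n + 2 * k + 1)
ExpBeatsPoly-diagonal {k} 2≤k ≤′-refl = ExpBeatsPoly-base k 2≤k
ExpBeatsPoly-diagonal {k} {suc n} 2≤k (≤′-step n₀≤n) =
  ExpBeatsPoly-suc-n-c k n _ (4k≤n+c (≤-trans (n≤2^n∸n k) (≤′⇒≤ n₀≤n)) ≤-refl)
    (ExpBeatsPoly-diagonal 2≤k n₀≤n)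

ExpBeatsPoly-above : ∀ {k n c} → 2 ≤ k → 2 ^ k ∸ k ≤ n → n + 2 * k + 1 ≤′ c → ExpBeatsPoly k n c
ExpBeatsPoly-above 2≤k n₀≤n ≤′-refl = ExpBeatsPoly-diagonal 2≤k (≤⇒≤′ n₀≤n)
ExpBeatsPoly-above {k} {n} {suc c} 2≤k n₀≤n (≤′-step n+2k+1≤c) =
  ExpBeatsPoly-suc-c k n c (4k≤n+c (≤-trans (n≤2^n∸n k) n₀≤n) (≤′⇒≤ n+2k+1≤c))
    (ExpBeatsPoly-above 2≤k n₀≤n n+2k+1≤c)

n*2^[b∸n]≤2^m*b^[1+m]⇒¬ExpBeatsPoly : ∀ m n b → n ≤ b → n * 2 ^ (b ∸ n) ≤ 2 ^ m * b ^ suc m →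
                                       ¬ ExpBeatsPoly (suc m) n (b ∸ n)
n*2^[b∸n]≤2^m*b^[1+m]⇒¬ExpBeatsPoly m n b n≤b bound beats = <⇒≱ beats (begin
  2 * n * 2 ^ c                  ≡⟨ *-assoc 2 n (2 ^ c) ⟩
  2 * (n * 2 ^ c)                ≤⟨ *-monoʳ-≤ 2 bound ⟩
  2 * (2 ^ m * b ^ suc m)        ≡⟨ *-assoc 2 (2 ^ m) _ ⟨
  2 ^ suc m * b ^ suc m          ≡⟨ cong (λ x → 2 ^ suc m * x ^ suc m) (m+[n∸m]≡n n≤b) ⟨
  2 ^ suc m * (n + c) ^ suc m    ∎)
  where
  open ≤-Reasoning
  c = b ∸ n

mainTheorem11 : (k n : ℕ) → 2 ≤ k → 1 ≤ n → (2 ^ k) ∸ k ≤ n →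
    (a : Fin k → ℕ) → (∀ i → 1 ≤ a i) → (∀ i j → i <ᶠ j → a i < a j) →
    term n ≡ sumℚ (λ i → term (a i)) →
    (last : Fin k) → toℕ last + 1 ≡ k →
    a last ≤ 2 * (k + n)
mainTheorem11 0 n ()
mainTheorem11 1 n (s≤s ())
-- The hypothesis 1 ≤ n is implied by 2^k − k ≤ n.
mainTheorem11 k@(suc (suc m)) n 2≤k _ n₀≤n a 1≤a inc eq last last+1≡k =
  subst (_≤ 2 * (k + n)) (cong a (sym (last≡fromℕ last last+1≡k))) (≮⇒≥ b-not-large)
  where
  b = a (fromℕ (suc m))
  a≤b : ∀ i → a i ≤ b
  a≤b = Increasing⇒≤last inc
  cleared : n * 2 ^ b ≡ clearedSum b a * 2 ^ n
  cleared = term≡sumℚ⇒cleared n b a a≤b eq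
  n<a₀ : n < head a
  n<a₀ = cleared⇒n<head n b a inc (1≤a _) (a≤b _) cleared
  b-not-large : ¬ 2 * (k + n) < b
  b-not-large 2[k+n]<b = n*2^[b∸n]≤2^m*b^[1+m]⇒¬ExpBeatsPoly (suc m) n b
    (<⇒≤ (<-≤-trans n<a₀ (a≤b _)))
    (cleared⇒n*2^[b∸n]≤2^k*b^[1+k] n b a inc refl n<a₀ cleared)
    (ExpBeatsPoly-above 2≤k n₀≤n (≤⇒≤′ (m+n≤o⇒m≤o∸n (n + 2 * k + 1) (subst (_≤ b) (regroup k n) 2[k+n]<b))))
    where
    regroup : ∀ k n → suc (2 * (k + n)) ≡ n + 2 * k + 1 + n
    regroup = solve-∀
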